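{- Consider a run of Algorithm Greedy-Filtering (context) on a non-negative submodular $f$, a matroid $\mathcal M$ of rank $r\in\mathbb N^+$, a permutation $\pi$ and $\varepsilon\in(0,\tfrac12)$, with the resulting $s_1,\dots,s_r$, $S_0,\dots,S_r$, $V_0,\dots,V_r$ and $I$. Suppose that for some $i\in[r]$ there exists $j<i$ with $\lfloor f(\{s_i\}|S_{i-1})\rfloor_I\ge\lfloor f(\{s_j\}|S_{j-1})\rfloor_I$. Then every element $e\in[n]$ with $S_{i-1}\cup\{e\}\in\mathcal M$ and $\lfloor f(\{e\}|S_{i-1})\rfloor_I>\lfloor f(\{s_i\}|S_{i-1})\rfloor_I$ also satisfies $S_{j-1}\cup\{e\}\in\mathcal M$ and $\lfloor f(\{e\}|S_{j-1})\rfloor_I>\lfloor f(\{s_j\}|S_{j-1})\rfloor_I$. In particular $H_i=H_{i-1}$, where for $\ell\in[r]$, $G_\ell:=\{e\in[n]\setminus(V_0\cup\dots\cup V_\ell): S_{\ell-1}\cup\{e\}\in\mathcal M,\ \lfloor f(\{e\}|S_{\ell-1})\rfloor_I>\lfloor f(\{s_\ell\}|S_{\ell-1})\rfloor_I\}$, $H_\ell:=\bigcup_{m=1}^{\ell}G_m$, and $H_0:=\emptyset$.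
   Context: $f(X|Y):=f(X\cup Y)-f(Y)$; submodular means $f(X|Y)\ge f(X|Z)$ for $Y\subseteq Z$. Rounding operator for finite nonempty $I\subset\mathbb R$: $\lfloor a\rfloor_I=\max\{i\in I:i\le a\}$ if $a\ge\min I$, else $\min I$. Relevant part of Algorithm Greedy-Filtering$(f,\mathcal M,r,\pi,\varepsilon)$: $V_0:=\{\pi(1),\dots,\pi(\lceil\varepsilon n\rceil)\}$, $w:=\frac r\varepsilon\max_{e\in V_0}f(\{e\})$. For $i\in[r]$, $V_i:=\{\pi(j):j=\lceil\varepsilon n\rceil+(i-1)\lceil\varepsilon n/r\rceil+1,\dots,\lceil\varepsilon n\rceil+i\lceil\varepsilon n/r\rceil\}$; $s_1:=\arg\max_{e\in V_1}f(\{e\})$, $S_0:=\emptyset$, $S_1:=\{s_1\}$; for $i=2..r$: $s_i:=\arg\max\{f(\{e\}|S_{i-1}):e\in V_i\cup\{s_1\},S_{i-1}\cup\{e\}\in\mathcal M\}$, $S_i:=S_{i-1}\cup\{s_i\}$. $I:=\{(1+\varepsilon)^i\varepsilon^2w/r^2:i=0,\dots,\lceil2\log_{1+\varepsilon}(r/\varepsilon)\rceil\}$.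
   Formalization: The set function f takes rational values and the parameter ε is rational, rather than real. -}

module Defs where

open import Data.Nat as ℕ using (ℕ; zero; suc; NonZero)
open import Data.Integer as ℤ using (ℤ; +_)
open import Data.Rational using (ℚ; 0ℚ; 1ℚ; _+_; _*_; _-_; _≤_; _<_; _≤ᵇ_; _⊔_; _⊓_; 1/_; ceiling; positive)
import Data.Rational as Q
open import Data.Rational.Properties using (pos⇒nonZero)
open import Data.Fin using (Fin; toℕ)
open import Data.Fin.Subset using (Subset; ⊥; ⁅_⁆; _∪_; _∈_; _∉_; _⊆_; ∣_∣)
open import Data.Fin.Permutation using (Permutation′; _⟨$⟩ʳ_)
open import Data.List using (List; []; _∷_; map; upTo; foldr)
open import Data.List.NonEmpty using (List⁺; _∷_; toList)
open import Data.Maybe using (Maybe; just; nothing; maybe)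
open import Data.Bool using (if_then_else_)
open import Data.Sum using (_⊎_)
open import Relation.Nullary using (¬_)
open import Data.Product using (Σ; ∃-syntax; _×_; _,_)
open import Relation.Binary.PropositionalEquality using (_≡_)

marg : ∀ {n} → (Subset n → ℚ) → Subset n → Subset n → ℚ
marg f X Y = f (X ∪ Y) - f Y

NonNegative : ∀ {n} → (Subset n → ℚ) → Set
NonNegative f = ∀ X → 0ℚ ≤ f X

Submodular : ∀ {n} → (Subset n → ℚ) → Set
Submodular f = ∀ X Y Z → Y ⊆ Z → marg f X Z ≤ marg f X Y

record Matroid (n : ℕ) : Set₁ where
  field
    Indep     : Subset n → Set
    indep-∅   : Indep ⊥
    indep-⊆   : ∀ {A B} → A ⊆ B → Indep B → Indep A
    indep-exc : ∀ {A B} → Indep A → Indep B → ∣ A ∣ ℕ.< ∣ B ∣ →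
                ∃[ e ] (e ∈ B × e ∉ A × Indep (A ∪ ⁅ e ⁆))

HasRank : ∀ {n} → Matroid n → ℕ → Set
HasRank M r = (∃[ A ] (Indep A × ∣ A ∣ ≡ r)) × (∀ A → Indep A → ∣ A ∣ ℕ.≤ r)
  where open Matroid M

ℕtoℚ : ℕ → ℚ
ℕtoℚ m = + m Q./ 1

pow : ℚ → ℕ → ℚ
pow x zero    = 1ℚ
pow x (suc k) = x * pow x k

-- ⌈ q ⌉ as a natural number (only applied to non-negative q)
ceilℕ : ℚ → ℕ
ceilℕ q = ℤ.∣ ceiling q ∣

maxLE : ℚ → List ℚ → Maybe ℚ
maxLE a []       = nothing
maxLE a (x ∷ xs) with maxLE a xs
... | nothing = if x ≤ᵇ a then just x else nothing
... | just m  = if x ≤ᵇ a then just (x ⊔ m) else just m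

minimum⁺ : List⁺ ℚ → ℚ
minimum⁺ (x ∷ xs) = foldr _⊓_ x xs

-- ⌊ a ⌋_I = max{i ∈ I : i ≤ a} if a ≥ min I, and min I otherwise
roundI : List⁺ ℚ → ℚ → ℚ
roundI I a = maybe (λ m → m) (minimum⁺ I) (maxLE a (toList I))

module Greedy {n : ℕ} (f : Subset n → ℚ) (M : Matroid n)
              (r : ℕ) .{{r≢0 : NonZero r}} (π : Permutation′ n)
              (ε : ℚ) (ε>0 : 0ℚ < ε) where

  open Matroid M public

  1/ε : ℚ
  1/ε = (1/ ε) {{pos⇒nonZero ε {{positive ε>0}}}}

  1/r : ℚ
  1/r = + 1 Q./ r

  c₀ : ℕ
  c₀ = ceilℕ (ε * ℕtoℚ n)

  c : ℕ
  c = ceilℕ (ε * ℕtoℚ n * 1/r)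

  -- V_m = {π(j) : lo m < j ≤ hi m} (j 1-based), i.e. π applied to the
  -- 0-based positions k with lo m ≤ k < hi m
  lo hi : ℕ → ℕ
  lo zero    = 0
  lo (suc m) = c₀ ℕ.+ m ℕ.* c
  hi zero    = c₀
  hi (suc m) = c₀ ℕ.+ suc m ℕ.* c

  _∈V_ : Fin n → ℕ → Set
  e ∈V m = ∃[ k ] ((π ⟨$⟩ʳ k ≡ e) × (lo m ℕ.≤ toℕ k) × (toℕ k ℕ.< hi m))

  single : Fin n → ℚ
  single e = f ⁅ e ⁆

  IsW : ℚ → Set
  IsW w = (∃[ e ] (e ∈V 0 × w ≡ ℕtoℚ r * 1/ε * single e))
        × (∀ e → e ∈V 0 → ℕtoℚ r * 1/ε * single e ≤ w)

  -- K = ⌈ 2 log_{1+ε}(r/ε) ⌉ = ⌈ log_{1+ε}((r/ε)^2) ⌉, i.e. the least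
  -- natural number K with (r/ε)^2 ≤ (1+ε)^K (this logarithm is positive
  -- since r/ε > 1, so the least natural equals the ceiling)
  IsK : ℕ → Set
  IsK K = (pow (ℕtoℚ r * 1/ε) 2 ≤ pow (1ℚ + ε) K)
        × (∀ m → pow (ℕtoℚ r * 1/ε) 2 ≤ pow (1ℚ + ε) m → K ℕ.≤ m)

  Iel : ℚ → ℕ → ℚ
  Iel w i = pow (1ℚ + ε) i * (ε * ε * w) * (1/r * 1/r)

  I : ℚ → ℕ → List⁺ ℚ
  I w K = Iel w 0 ∷ map (λ i → Iel w (suc i)) (upTo K)

  -- S_0 = ∅, S_i = S_{i-1} ∪ {s_i}   (s indexed 1..r)
  S : (ℕ → Fin n) → ℕ → Subset n
  S s zero    = ⊥
  S s (suc i) = S s i ∪ ⁅ s (suc i) ⁆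

  IsRun : (ℕ → Fin n) → Set
  IsRun s =
      (s 1 ∈V 1 × (∀ e → e ∈V 1 → single e ≤ single (s 1)))
    × (∀ i → 2 ℕ.≤ i → i ℕ.≤ r →
         let Sp = S s (ℕ.pred i) in
           ((s i ∈V i ⊎ s i ≡ s 1) × Indep (Sp ∪ ⁅ s i ⁆))
         × (∀ e → (e ∈V i ⊎ e ≡ s 1) → Indep (Sp ∪ ⁅ e ⁆) →
              marg f ⁅ e ⁆ Sp ≤ marg f ⁅ s i ⁆ Sp))

  rnd : ℚ → ℕ → ℚ → ℚ
  rnd w K a = roundI (I w K) a

  module _ (s : ℕ → Fin n) (w : ℚ) (K : ℕ) where
    ⌊_⌋ : ℚ → ℚ
    ⌊ a ⌋ = rnd w K a

    InG : ℕ → Fin n → Set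
    InG ℓ e = (∀ m → m ℕ.≤ ℓ → ¬ (e ∈V m))
            × Indep (S s (ℕ.pred ℓ) ∪ ⁅ e ⁆)
            × (⌊ marg f ⁅ s ℓ ⁆ (S s (ℕ.pred ℓ)) ⌋ < ⌊ marg f ⁅ e ⁆ (S s (ℕ.pred ℓ)) ⌋)

    InH : ℕ → Fin n → Set
    InH ℓ e = ∃[ m ] (1 ℕ.≤ m × m ℕ.≤ ℓ × InG m e)

-- Since S_{j-1} ⊆ S_{i-1}, submodularity gives f({e}|S_{i-1}) ≤ f({e}|S_{j-1}), and rounding to I
-- is monotone, so an element whose rounded gain beats s_i at step i also beats s_j at step j;
-- independence of S_{i-1} ∪ {e} passes down to the subset S_{j-1} ∪ {e}. Hence G_i ⊆ G_j ⊆ H_{i-1}.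
-- Nothing else about the run (the choice of the s_ℓ, w, K, non-negativity, the rank) is needed.
module Submission where

open import Defs
open import Data.Nat as ℕ using (ℕ; NonZero; pred)
open import Data.Rational using (ℚ; 0ℚ; ½; _<_; _≤_)
open import Data.Fin using (Fin)
open import Data.Fin.Subset using (Subset; ⁅_⁆; _∪_)
open import Data.Fin.Permutation using (Permutation′)
open import Data.Product using (_×_)
open import Function.Bundles using (_⇔_)

open import Data.Bool using (true; false)
open import Data.Bool.Properties using (T-≡)
open import Data.Fin.Subset using (_⊆_)
open import Data.Fin.Subset.Properties using (p⊆p∪q; x∈p∪q⁻; x∈p∪q⁺)
open import Data.List using (_∷_)
open import Data.List.Membership.Propositional using (_∈_)
open import Data.List.NonEmpty using (_∷_; toList)
open import Data.List.Properties using (foldr-preservesᵒ)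
open import Data.List.Relation.Unary.Any using (Any; here; there)
import Data.List.Relation.Unary.Any as Any
open import Data.Maybe using (just; nothing)
import Data.Nat.Properties as ℕ
open import Data.Product using (∃-syntax; _,_)
open import Data.Rational using (_≤ᵇ_; _⊔_; _⊓_)
open import Data.Rational.Properties
open import Data.Sum using (_⊎_; inj₁; inj₂; [_,_])
open import Function using (_∘_)
open import Function.Bundles using (mk⇔; Equivalence)
open import Relation.Binary.PropositionalEquality using (_≡_; refl; sym; subst)

≤⇒≤ᵇ≡true : ∀ {p q} → p ≤ q → (p ≤ᵇ q) ≡ true
≤⇒≤ᵇ≡true = Equivalence.to T-≡ ∘ ≤⇒≤ᵇ

≤ᵇ≡true⇒≤ : ∀ {p} {q} → (p ≤ᵇ q) ≡ true → p ≤ q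
≤ᵇ≡true⇒≤ {p} {q} = ≤ᵇ⇒≤ {p} {q} ∘ Equivalence.from T-≡

maxLE-≤ : ∀ a xs {m} → maxLE a xs ≡ just m → m ≤ a
maxLE-≤ a (x ∷ xs) eq with maxLE a xs in eqxs
... | nothing with x ≤ᵇ a in x≤a
maxLE-≤ a (x ∷ xs) refl | nothing | true  = ≤ᵇ≡true⇒≤ {x} x≤a
maxLE-≤ a (x ∷ xs) eq   | just m with x ≤ᵇ a in x≤a
maxLE-≤ a (x ∷ xs) refl | just m | true  = ⊔-lub (≤ᵇ≡true⇒≤ {x} x≤a) (maxLE-≤ a xs eqxs)
maxLE-≤ a (x ∷ xs) refl | just m | false = maxLE-≤ a xs eqxs

maxLE-∈ : ∀ a xs {m} → maxLE a xs ≡ just m → m ∈ xs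
maxLE-∈ a (x ∷ xs) eq with maxLE a xs in eqxs
... | nothing with x ≤ᵇ a
maxLE-∈ a (x ∷ xs) refl | nothing | true = here refl
maxLE-∈ a (x ∷ xs) eq   | just m with x ≤ᵇ a
maxLE-∈ a (x ∷ xs) refl | just m | false = there (maxLE-∈ a xs eqxs)
maxLE-∈ a (x ∷ xs) refl | just m | true with ⊔-sel x m
... | inj₁ x⊔m≡x = here x⊔m≡x
... | inj₂ x⊔m≡m = there (subst (_∈ xs) (sym x⊔m≡m) (maxLE-∈ a xs eqxs))

maxLE-maximal : ∀ a xs {y} → y ∈ xs → y ≤ a → ∃[ m ] (maxLE a xs ≡ just m × y ≤ m)
maxLE-maximal a (x ∷ xs) (here refl) x≤a with maxLE a xs
... | nothing rewrite ≤⇒≤ᵇ≡true x≤a = x , refl , ≤-refl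
... | just m  rewrite ≤⇒≤ᵇ≡true x≤a = x ⊔ m , refl , p≤p⊔q x m
maxLE-maximal a (x ∷ xs) (there y∈xs) y≤a with maxLE a xs | maxLE-maximal a xs y∈xs y≤a
... | just m | m , refl , y≤m with x ≤ᵇ a
...   | true  = x ⊔ m , refl , ≤-trans y≤m (p≤q⊔p x m)
...   | false = m , refl , y≤m

minimum⁺-≤ : ∀ I {y} → y ∈ toList I → minimum⁺ I ≤ y
minimum⁺-≤ (x ∷ xs) {y} y∈I = foldr-preservesᵒ ⊓-≤ x xs (locate y∈I)
  where
  ⊓-≤ : ∀ p q → p ≤ y ⊎ q ≤ y → p ⊓ q ≤ y
  ⊓-≤ p q = [ p≤q⇒p⊓r≤q q , p≤q⇒r⊓p≤q p ]
  locate : y ∈ x ∷ xs → x ≤ y ⊎ Any (_≤ y) xs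
  locate (here refl)  = inj₁ ≤-refl
  locate (there y∈xs) = inj₂ (Any.map (≤-reflexive ∘ sym) y∈xs)

minimum⁺≤roundI : ∀ I a → minimum⁺ I ≤ roundI I a
minimum⁺≤roundI I a with maxLE a (toList I) in eq
... | nothing = ≤-refl
... | just m  = minimum⁺-≤ I (maxLE-∈ a (toList I) eq)

roundI-mono : ∀ I {a b} → a ≤ b → roundI I a ≤ roundI I b
roundI-mono I {a} {b} a≤b with maxLE a (toList I) in eq
... | nothing = minimum⁺≤roundI I b
... | just m
  with maxLE-maximal b (toList I) (maxLE-∈ a (toList I) eq) (≤-trans (maxLE-≤ a (toList I) eq) a≤b)
...   | m′ , eq′ , m≤m′ rewrite eq′ = m≤m′

roundI-marg-antitone : ∀ {n} {f : Subset n → ℚ} → Submodular f →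
                       ∀ I X {Y Z} → Y ⊆ Z → roundI I (marg f X Z) ≤ roundI I (marg f X Y)
roundI-marg-antitone sub I X {Y} {Z} Y⊆Z = roundI-mono I (sub X Y Z Y⊆Z)

∪-monoˡ : ∀ {n} {A B : Subset n} (C : Subset n) → A ⊆ B → A ∪ C ⊆ B ∪ C
∪-monoˡ {A = A} C A⊆B x∈A∪C with x∈p∪q⁻ A C x∈A∪C
... | inj₁ x∈A = x∈p∪q⁺ (inj₁ (A⊆B x∈A))
... | inj₂ x∈C = x∈p∪q⁺ (inj₂ x∈C)

module GreedyProperties {n : ℕ} (f : Subset n → ℚ) (M : Matroid n) (r : ℕ) .{{_ : NonZero r}}
                       (π : Permutation′ n) (ε : ℚ) (ε>0 : 0ℚ < ε) where

  open Greedy f M r π ε ε>0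

  S-mono : ∀ s {a b} → a ℕ.≤ b → S s a ⊆ S s b
  S-mono s = S-mono′ ∘ ℕ.≤⇒≤′
    where
    S-mono′ : ∀ {a b} → a ℕ.≤′ b → S s a ⊆ S s b
    S-mono′ ℕ.≤′-refl        = λ x∈ → x∈
    S-mono′ (ℕ.≤′-step a≤′b) = p⊆p∪q _ ∘ S-mono′ a≤′b

  module _ (s : ℕ → Fin n) (w : ℚ) (K : ℕ) where

    roundedGain : Fin n → ℕ → ℚ
    roundedGain e ℓ = rnd w K (marg f ⁅ e ⁆ (S s (pred ℓ)))

    improvement-persists : Submodular f → ∀ {i j} → j ℕ.≤ i →
      roundedGain (s j) j ≤ roundedGain (s i) i →
      ∀ e → Indep (S s (pred i) ∪ ⁅ e ⁆) → roundedGain (s i) i < roundedGain e i →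
      Indep (S s (pred j) ∪ ⁅ e ⁆) × roundedGain (s j) j < roundedGain e j
    improvement-persists sub {i} {j} j≤i sⱼ≤sᵢ e indep sᵢ<e =
        indep-⊆ (∪-monoˡ ⁅ e ⁆ Sⱼ⊆Sᵢ) indep
      , ≤-<-trans sⱼ≤sᵢ (<-≤-trans sᵢ<e (roundI-marg-antitone {f = f} sub (I w K) ⁅ e ⁆ Sⱼ⊆Sᵢ))
      where
      Sⱼ⊆Sᵢ : S s (pred j) ⊆ S s (pred i)
      Sⱼ⊆Sᵢ = S-mono s (ℕ.pred-mono-≤ j≤i)

    InG-descends : Submodular f → ∀ {i j} → j ℕ.≤ i →
      roundedGain (s j) j ≤ roundedGain (s i) i →
      ∀ {e} → InG s w K i e → InG s w K j e
    InG-descends sub j≤i sⱼ≤sᵢ {e} (outside , indep , sᵢ<e) =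
        (λ m m≤j → outside m (ℕ.≤-trans m≤j j≤i))
      , improvement-persists sub j≤i sⱼ≤sᵢ e indep sᵢ<e

    InH-pred⇔ : ∀ i → (∀ {e} → InG s w K i e → InH s w K (pred i) e) →
                ∀ e → InH s w K i e ⇔ InH s w K (pred i) e
    InH-pred⇔ i Gᵢ⊆Hᵢ₋₁ e = mk⇔ to from
      where
      to : InH s w K i e → InH s w K (pred i) e
      to (m , 1≤m , m≤i , g) with ℕ.m≤n⇒m<n∨m≡n m≤i
      ... | inj₁ m<i  = m , 1≤m , ℕ.<⇒≤pred m<i , g
      ... | inj₂ refl = Gᵢ⊆Hᵢ₋₁ g
      from : InH s w K (pred i) e → InH s w K i e
      from (m , 1≤m , m≤i-1 , g) = m , 1≤m , ℕ.≤-trans m≤i-1 ℕ.pred[n]≤n , g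

claim3p5 : {n : ℕ} (f : Subset n → ℚ) → NonNegative f → Submodular f →
    (M : Matroid n) (r : ℕ) .{{_ : NonZero r}} → HasRank M r →
    (π : Permutation′ n) (ε : ℚ) (ε>0 : 0ℚ < ε) → ε < ½ →
    let open Greedy f M r π ε ε>0 in
    (w : ℚ) → IsW w → (K : ℕ) → IsK K →
    (s : ℕ → Fin n) → IsRun s →
    (i : ℕ) → 1 ℕ.≤ i → i ℕ.≤ r →
    (j : ℕ) → 1 ℕ.≤ j → j ℕ.< i →
    rnd w K (marg f ⁅ s j ⁆ (S s (pred j))) ≤ rnd w K (marg f ⁅ s i ⁆ (S s (pred i))) →
    ((e : Fin n) → Indep (S s (pred i) ∪ ⁅ e ⁆) →
       rnd w K (marg f ⁅ s i ⁆ (S s (pred i))) < rnd w K (marg f ⁅ e ⁆ (S s (pred i))) →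
       Indep (S s (pred j) ∪ ⁅ e ⁆)
       × rnd w K (marg f ⁅ s j ⁆ (S s (pred j))) < rnd w K (marg f ⁅ e ⁆ (S s (pred j))))
    × ((e : Fin n) → InH s w K i e ⇔ InH s w K (pred i) e)
claim3p5 f _ sub M r _ π ε ε>0 _ w _ K _ s _ i _ _ j 1≤j j<i sⱼ≤sᵢ =
    improvement-persists s w K sub j≤i sⱼ≤sᵢ
  , InH-pred⇔ s w K i (λ g → j , 1≤j , ℕ.<⇒≤pred j<i , InG-descends s w K sub j≤i sⱼ≤sᵢ g)
  where
  open GreedyProperties f M r π ε ε>0
  j≤i : j ℕ.≤ i
  j≤i = ℕ.<⇒≤ j<i
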